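{- Let $n\ge 5$ and let $\hat d=((2n-2)^2,(n-1)^{n-2})$. Then $\mathrm{MaxMult}(\hat d)=2$, and every loopless multigraph $H$ realizing $\hat d$ with $\mathrm{MaxMult}(H)=\mathrm{MaxMult}(\hat d)$ satisfies $\mathrm{TotMult}(H)\ge 2n-3$.
   Context: Multigraphs are loopless (parallel edges allowed). $H$ realizes $d$ if its degree sequence equals $d$. For a multigraph $H=(V,E)$ with edge multiset $E$, $\mathrm{TotMult}(H)=|E|-|E'|$, where $E'$ is the edge set of its underlying simple graph, and $\mathrm{MaxMult}(H)$ is the maximum number of parallel copies of an edge between any two vertices. $\mathrm{MaxMult}(d)$ is the minimum of $\mathrm{MaxMult}(H)$ over all loopless multigraphs $H$ realizing $d$. The notation $x^k$ in a sequence means $k$ entries equal to $x$. -}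

module Defs where

open import Data.Nat using (ℕ; _+_; _*_; _∸_; _⊔_; _<ᵇ_; _≤_)
open import Data.Fin using (Fin; toℕ)
open import Data.List using (List; map; foldr; allFin)
open import Data.Nat.ListAction using (sum)
open import Data.Bool using (if_then_else_)
open import Data.Product using (_×_; Σ)
open import Relation.Binary.PropositionalEquality using (_≡_)

record Multigraph (m : ℕ) : Set where
  field
    mult     : Fin m → Fin m → ℕ
    symmetric : ∀ i j → mult i j ≡ mult j i
    loopless : ∀ i → mult i i ≡ 0
open Multigraph public

Σv : ∀ {m} → (Fin m → ℕ) → ℕ
Σv {m} f = sum (map f (allFin m))

Maxv : ∀ {m} → (Fin m → ℕ) → ℕ
Maxv {m} f = foldr _⊔_ 0 (map f (allFin m))

ΣPairs : ∀ {m} → (Fin m → Fin m → ℕ) → ℕ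
ΣPairs f = Σv (λ i → Σv (λ j → if toℕ i <ᵇ toℕ j then f i j else 0))

deg : ∀ {m} → Multigraph m → Fin m → ℕ
deg H v = Σv (λ u → mult H v u)

Realizes : ∀ {m} → Multigraph m → (Fin m → ℕ) → Set
Realizes H d = ∀ v → deg H v ≡ d v

numEdges : ∀ {m} → Multigraph m → ℕ
numEdges H = ΣPairs (mult H)

numSimpleEdges : ∀ {m} → Multigraph m → ℕ
numSimpleEdges H = ΣPairs (λ i j → if 0 <ᵇ mult H i j then 1 else 0)

TotMult : ∀ {m} → Multigraph m → ℕ
TotMult H = numEdges H ∸ numSimpleEdges H

MaxMult : ∀ {m} → Multigraph m → ℕ
MaxMult H = Maxv (λ i → Maxv (λ j → mult H i j))

-- MaxMult(d) = k : k is the minimum of MaxMult(H) over all realizations H of d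
MaxMultSeqIs : ∀ {m} → (Fin m → ℕ) → ℕ → Set
MaxMultSeqIs {m} d k =
  Σ (Multigraph m) (λ H → Realizes H d × MaxMult H ≡ k)
  × (∀ (H : Multigraph m) → Realizes H d → k ≤ MaxMult H)

dhat : (n : ℕ) → Fin n → ℕ
dhat n v = if toℕ v <ᵇ 2 then 2 * n ∸ 2 else n ∸ 1

module Submission where

-- Vertex 0 of a realization of d̂ = ((2n−2)², (n−1)^(n−2)) has degree 2(n−1) but only n−1
-- neighbours, so some multiplicity is at least 2.  If all multiplicities are at most 2,
-- then vertices 0 and 1 must be joined to every other vertex by exactly two edges, and
-- these (n−1) + (n−2) doubled pairs alone give TotMult ≥ 2n−3.  The bound 2 is attained:
-- join 0 and 1 doubly to all vertices and put on the remaining n−2 vertices the complement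
-- of an (n−2)-cycle, which is (n−5)-regular.

open import Defs
open import Data.Nat using (ℕ; _≤_; _*_; _∸_)
open import Data.Product using (_×_)
open import Relation.Binary.PropositionalEquality using (_≡_)

open import Data.Bool using (true; false; if_then_else_)
open import Data.Fin using (Fin; zero; suc; toℕ; punchIn; _≟_; fromℕ; inject₁)
open import Data.Fin.Permutation
  using (Permutation; permutation; _⟨$⟩ʳ_; _⟨$⟩ˡ_; inverseˡ; inverseʳ)
open import Data.Fin.Properties using (punchInᵢ≢i; toℕ-inject₁)
open import Data.Fin.Relation.Unary.Top
  using (view; ‵fromℕ; ‵inject₁; view-fromℕ; view-inject₁)
import Data.List as List
open import Data.Nat using (zero; suc; _+_; _⊔_; _<ᵇ_; pred; z≤n)
open import Data.Nat.Properties hiding (_≟_)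
open import Algebra.Properties.CommutativeMonoid.Sum +-0-commutativeMonoid
  using (sum; sum-syntax; sum-remove; sum-cong-≗; ∑-distrib-+)
open import Data.Nat.Tactic.RingSolver using (solve-∀)
open Data.Product using (_,_; proj₁; proj₂)
import Data.Vec.Functional as Vector
open import Function using (_∘_; id)
open Relation.Binary.PropositionalEquality
  using (refl; sym; trans; cong; cong₂; subst; _≢_; module ≡-Reasoning)
open import Relation.Nullary using (yes; no; does; contradiction)
open import Relation.Nullary.Decidable using (dec-true; dec-false)

private
  variable
    m n : ℕ

foldr-map-tabulate : ∀ {A B C : Set} (g : B → C → C) (e : C) (f : A → B) (h : Fin m → A) →
                     List.foldr g e (List.map f (List.tabulate h)) ≡ Vector.foldr g e (f ∘ h)
foldr-map-tabulate {zero}  g e f h = refl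
foldr-map-tabulate {suc m} g e f h = cong (g (f (h zero))) (foldr-map-tabulate g e f (h ∘ suc))

Σv≡∑ : (f : Fin m → ℕ) → Σv f ≡ ∑[ i < m ] f i
Σv≡∑ f = foldr-map-tabulate _+_ 0 f id

∑-const : ∀ m c → ∑[ i < m ] c ≡ m * c
∑-const zero    c = refl
∑-const (suc m) c = cong (c +_) (∑-const m c)

∑-mono-≤ : {f g : Fin m → ℕ} → (∀ i → f i ≤ g i) → ∑[ i < m ] f i ≤ ∑[ i < m ] g i
∑-mono-≤ {zero}  f≤g = ≤-refl
∑-mono-≤ {suc m} f≤g = +-mono-≤ (f≤g zero) (∑-mono-≤ (f≤g ∘ suc))

∑≤* : ∀ {c} {f : Fin m → ℕ} → (∀ i → f i ≤ c) → ∑[ i < m ] f i ≤ m * c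
∑≤* {m} {c} f≤c = ≤-trans (∑-mono-≤ f≤c) (≤-reflexive (∑-const m c))

*≤∑ : ∀ {c} {f : Fin m → ℕ} → (∀ i → c ≤ f i) → m * c ≤ ∑[ i < m ] f i
*≤∑ {m} {c} c≤f = ≤-trans (≤-reflexive (sym (∑-const m c))) (∑-mono-≤ c≤f)

∑≤*-tight : ∀ {c} {f : Fin m → ℕ} → (∀ i → f i ≤ c) → m * c ≤ ∑[ i < m ] f i →
            ∀ i → f i ≡ c
∑≤*-tight {suc m} {c} {f} f≤c tight i = ≤-antisym (f≤c i) (+-cancelʳ-≤ (m * c) c (f i) (begin
  c + m * c                        ≤⟨ tight ⟩
  ∑[ j < suc m ] f j               ≡⟨ sum-remove {i = i} f ⟩
  f i + ∑[ j < m ] f (punchIn i j) ≤⟨ +-monoʳ-≤ (f i) (∑≤* (f≤c ∘ punchIn i)) ⟩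
  f i + m * c                      ∎))
  where open ≤-Reasoning

foldr-⊔-upper : (f : Fin m → ℕ) → ∀ i → f i ≤ Vector.foldr _⊔_ 0 f
foldr-⊔-upper f zero    = m≤m⊔n (f zero) _
foldr-⊔-upper f (suc i) = ≤-trans (foldr-⊔-upper (f ∘ suc) i) (m≤n⊔m (f zero) _)

foldr-⊔-least : ∀ {c} (f : Fin m → ℕ) → (∀ i → f i ≤ c) → Vector.foldr _⊔_ 0 f ≤ c
foldr-⊔-least {zero}  f f≤c = z≤n
foldr-⊔-least {suc m} f f≤c = ⊔-lub (f≤c zero) (foldr-⊔-least (f ∘ suc) (f≤c ∘ suc))

Maxv-upper : (f : Fin m → ℕ) → ∀ i → f i ≤ Maxv f
Maxv-upper f i = subst (f i ≤_) (sym (foldr-map-tabulate _⊔_ 0 f id)) (foldr-⊔-upper f i)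

Maxv-least : ∀ {c} (f : Fin m → ℕ) → (∀ i → f i ≤ c) → Maxv f ≤ c
Maxv-least f f≤c = subst (_≤ _) (sym (foldr-map-tabulate _⊔_ 0 f id)) (foldr-⊔-least f f≤c)

deg≡∑ : (H : Multigraph m) (v : Fin m) → deg H v ≡ ∑[ u < m ] mult H v u
deg≡∑ H v = Σv≡∑ (mult H v)

deg≡∑-punchIn : (H : Multigraph (suc m)) (v : Fin (suc m)) →
                deg H v ≡ ∑[ u < m ] mult H v (punchIn v u)
deg≡∑-punchIn {m} H v = begin
  deg H v                     ≡⟨ deg≡∑ H v ⟩
  ∑[ u < suc m ] mult H v u   ≡⟨ sum-remove {i = v} (mult H v) ⟩
  mult H v v + others         ≡⟨ cong (_+ others) (loopless H v) ⟩
  others                      ∎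
  where
  open ≡-Reasoning
  others : ℕ
  others = ∑[ u < m ] mult H v (punchIn v u)

mult≤MaxMult : (H : Multigraph m) → ∀ i j → mult H i j ≤ MaxMult H
mult≤MaxMult H i j = ≤-trans (Maxv-upper (mult H i) j) (Maxv-upper (λ i → Maxv (mult H i)) i)

MaxMult-least : ∀ {c} (H : Multigraph m) → (∀ i j → mult H i j ≤ c) → MaxMult H ≤ c
MaxMult-least H mult≤c = Maxv-least _ (λ i → Maxv-least (mult H i) (mult≤c i))

deg≤*MaxMult : (H : Multigraph (suc m)) (v : Fin (suc m)) → deg H v ≤ m * MaxMult H
deg≤*MaxMult {m} H v = begin
  deg H v                           ≡⟨ deg≡∑-punchIn H v ⟩
  ∑[ u < m ] mult H v (punchIn v u) ≤⟨ ∑≤* (mult≤MaxMult H v ∘ punchIn v) ⟩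
  m * MaxMult H                     ∎
  where open ≤-Reasoning

saturated : ∀ {c} (H : Multigraph (suc m)) (v : Fin (suc m)) → MaxMult H ≤ c → m * c ≤ deg H v →
            ∀ u → mult H v (punchIn v u) ≡ c
saturated {m} H v MaxMult≤c m*c≤deg =
  ∑≤*-tight (λ u → ≤-trans (mult≤MaxMult H v (punchIn v u)) MaxMult≤c)
            (≤-trans m*c≤deg (≤-reflexive (deg≡∑-punchIn H v)))

above : (Fin m → Fin m → ℕ) → Fin m → Fin m → ℕ
above f i j = if toℕ i <ᵇ toℕ j then f i j else 0

ΣPairs≡∑∑ : (f : Fin m → Fin m → ℕ) → ΣPairs f ≡ ∑[ i < m ] ∑[ j < m ] above f i j
ΣPairs≡∑∑ f = trans (Σv≡∑ (λ i → Σv (above f i))) (sum-cong-≗ (λ i → Σv≡∑ (above f i)))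

ΣPairs-suc : (f : Fin (suc m) → Fin (suc m) → ℕ) →
             ΣPairs f ≡ ∑[ j < m ] f zero (suc j) + ΣPairs (λ i j → f (suc i) (suc j))
ΣPairs-suc {m} f = trans (ΣPairs≡∑∑ f) (cong (∑[ j < m ] f zero (suc j) +_) (sym (ΣPairs≡∑∑ f₊)))
  where
  f₊ : Fin m → Fin m → ℕ
  f₊ i j = f (suc i) (suc j)

ΣPairs-+ : {f g h : Fin m → Fin m → ℕ} → (∀ i j → h i j ≡ f i j + g i j) →
           ΣPairs h ≡ ΣPairs f + ΣPairs g
ΣPairs-+ {m} {f} {g} {h} h≡f+g = begin
  ΣPairs h
    ≡⟨ ΣPairs≡∑∑ h ⟩
  ∑[ i < m ] ∑[ j < m ] above h i j
    ≡⟨ sum-cong-≗ (λ i → sum-cong-≗ (above-+ i)) ⟩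
  ∑[ i < m ] ∑[ j < m ] (above f i j + above g i j)
    ≡⟨ sum-cong-≗ (λ i → ∑-distrib-+ (above f i) (above g i)) ⟩
  ∑[ i < m ] (∑[ j < m ] above f i j + ∑[ j < m ] above g i j)
    ≡⟨ ∑-distrib-+ (λ i → ∑[ j < m ] above f i j) (λ i → ∑[ j < m ] above g i j) ⟩
  ∑[ i < m ] ∑[ j < m ] above f i j + ∑[ i < m ] ∑[ j < m ] above g i j
    ≡⟨ sym (cong₂ _+_ (ΣPairs≡∑∑ f) (ΣPairs≡∑∑ g)) ⟩
  ΣPairs f + ΣPairs g ∎
  where
  open ≡-Reasoning
  above-+ : ∀ i j → above h i j ≡ above f i j + above g i j
  above-+ i j with toℕ i <ᵇ toℕ j
  ... | true  = h≡f+g i j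
  ... | false = refl

TotMult≡ΣPairs-pred : (H : Multigraph m) → TotMult H ≡ ΣPairs (λ i j → pred (mult H i j))
TotMult≡ΣPairs-pred {m} H = begin
  numEdges H ∸ numSimpleEdges H
    ≡⟨ cong (_∸ numSimpleEdges H) (ΣPairs-+ (λ i j → split (mult H i j))) ⟩
  numSimpleEdges H + ΣPairs P ∸ numSimpleEdges H
    ≡⟨ m+n∸m≡n (numSimpleEdges H) (ΣPairs P) ⟩
  ΣPairs P ∎
  where
  open ≡-Reasoning
  P : Fin m → Fin m → ℕ
  P i j = pred (mult H i j)
  split : ∀ x → x ≡ (if 0 <ᵇ x then 1 else 0) + pred x
  split zero    = refl
  split (suc x) = refl

TotMult-two-apexes : (H : Multigraph (2 + m)) →
                     (∀ u → 2 ≤ mult H zero (suc u)) →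
                     (∀ u → 2 ≤ mult H (suc zero) (suc (suc u))) →
                     suc m + m ≤ TotMult H
TotMult-two-apexes {m} H row₀ row₁ = begin
  suc m + m                 ≡⟨ sym (cong₂ _+_ (*-identityʳ (suc m)) (*-identityʳ m)) ⟩
  suc m * 1 + m * 1         ≤⟨ +-mono-≤ (*≤∑ (pred-mono-≤ ∘ row₀)) (*≤∑ (pred-mono-≤ ∘ row₁)) ⟩
  Row₀ + Row₁               ≤⟨ +-monoʳ-≤ Row₀ (m≤m+n Row₁ (ΣPairs P₂)) ⟩
  Row₀ + (Row₁ + ΣPairs P₂) ≡⟨ sym (trans (ΣPairs-suc P) (cong (Row₀ +_) (ΣPairs-suc P₁))) ⟩
  ΣPairs P                  ≡⟨ sym (TotMult≡ΣPairs-pred H) ⟩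
  TotMult H                 ∎
  where
  open ≤-Reasoning
  P : Fin (2 + m) → Fin (2 + m) → ℕ
  P i j = pred (mult H i j)
  P₁ : Fin (suc m) → Fin (suc m) → ℕ
  P₁ i j = P (suc i) (suc j)
  P₂ : Fin m → Fin m → ℕ
  P₂ i j = P₁ (suc i) (suc j)
  Row₀ Row₁ : ℕ
  Row₀ = ∑[ u < suc m ] P zero (suc u)
  Row₁ = ∑[ u < m ] P (suc zero) (suc (suc u))

coneMult : ℕ → (Fin m → Fin m → ℕ) → Fin (suc m) → Fin (suc m) → ℕ
coneMult c μ zero    zero    = 0
coneMult c μ zero    (suc _) = c
coneMult c μ (suc _) zero    = c
coneMult c μ (suc i) (suc j) = μ i j

cone : ℕ → Multigraph m → Multigraph (suc m)
cone c H = record { mult = coneMult c (mult H) ; symmetric = symmetric′ ; loopless = loopless′ }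
  where
  symmetric′ : ∀ i j → coneMult c (mult H) i j ≡ coneMult c (mult H) j i
  symmetric′ zero    zero    = refl
  symmetric′ zero    (suc _) = refl
  symmetric′ (suc _) zero    = refl
  symmetric′ (suc i) (suc j) = symmetric H i j
  loopless′ : ∀ i → coneMult c (mult H) i i ≡ 0
  loopless′ zero    = refl
  loopless′ (suc i) = loopless H i

deg-cone-apex : ∀ c (H : Multigraph m) → deg (cone c H) zero ≡ m * c
deg-cone-apex {m} c H = trans (deg≡∑ (cone c H) zero) (∑-const m c)

deg-cone-suc : ∀ c (H : Multigraph m) v → deg (cone c H) (suc v) ≡ c + deg H v
deg-cone-suc c H v = trans (deg≡∑ (cone c H) (suc v)) (cong (c +_) (sym (deg≡∑ H v)))

cone-mult≤ : ∀ {c} (H : Multigraph m) → (∀ i j → mult H i j ≤ c) →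
             ∀ i j → mult (cone c H) i j ≤ c
cone-mult≤ H mult≤c zero    zero    = z≤n
cone-mult≤ H mult≤c zero    (suc _) = ≤-refl
cone-mult≤ H mult≤c (suc _) zero    = ≤-refl
cone-mult≤ H mult≤c (suc i) (suc j) = mult≤c i j

δ : Fin m → Fin m → ℕ
δ i j = if does (i ≟ j) then 1 else 0

δ-refl : (i : Fin m) → δ i i ≡ 1
δ-refl i = cong (if_then 1 else 0) (dec-true (i ≟ i) refl)

δ-≢ : {i j : Fin m} → i ≢ j → δ i j ≡ 0
δ-≢ {i = i} {j} i≢j = cong (if_then 1 else 0) (dec-false (i ≟ j) i≢j)

δ-⇔ : {i j k l : Fin m} → (i ≡ j → k ≡ l) → (k ≡ l → i ≡ j) → δ i j ≡ δ k l
δ-⇔ {i = i} {j} {k} {l} to from with i ≟ j | k ≟ l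
... | yes _   | yes _   = refl
... | no _    | no _    = refl
... | yes i≡j | no k≢l  = contradiction (to i≡j) k≢l
... | no i≢j  | yes k≡l = contradiction (from k≡l) i≢j

δ-sym : (i j : Fin m) → δ i j ≡ δ j i
δ-sym i j = δ-⇔ {i = i} {j} sym sym

∑-δ : (i : Fin m) → ∑[ j < m ] δ i j ≡ 1
∑-δ {suc m} i = begin
  ∑[ j < suc m ] δ i j                 ≡⟨ sum-remove {i = i} (δ i) ⟩
  δ i i + ∑[ j < m ] δ i (punchIn i j) ≡⟨ cong₂ _+_ (δ-refl i) (sum-cong-≗ (λ j → δ-≢ (punchInᵢ≢i i j ∘ sym))) ⟩
  1 + ∑[ j < m ] 0                     ≡⟨ cong suc (trans (∑-const m 0) (*-zeroʳ m)) ⟩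
  1                                    ∎
  where open ≡-Reasoning

NoShortCycles : Permutation m m → Set
NoShortCycles π = ∀ a → π ⟨$⟩ʳ a ≢ a × π ⟨$⟩ʳ (π ⟨$⟩ʳ a) ≢ a

-- Counts how many of  b ≡ a,  b ≡ π a,  a ≡ π b  hold; at most one does when π has no
-- short cycles, so 1 ∸ cycleNbhd π is the complement of the graph formed by the cycles of π.
cycleNbhd : Permutation m m → Fin m → Fin m → ℕ
cycleNbhd π a b = δ a b + (δ (π ⟨$⟩ʳ a) b + δ (π ⟨$⟩ʳ b) a)

cycleNbhd-sym : (π : Permutation m m) → ∀ a b → cycleNbhd π a b ≡ cycleNbhd π b a
cycleNbhd-sym π a b = cong₂ _+_ (δ-sym a b) (+-comm (δ (π ⟨$⟩ʳ a) b) (δ (π ⟨$⟩ʳ b) a))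

cycleNbhd≤1 : (π : Permutation m m) → NoShortCycles π → ∀ a b → cycleNbhd π a b ≤ 1
cycleNbhd≤1 π noShort a b with a ≟ b | π ⟨$⟩ʳ a ≟ b | π ⟨$⟩ʳ b ≟ a
... | no _    | no _     | no _     = z≤n
... | yes _   | no _     | no _     = ≤-refl
... | no _    | yes _    | no _     = ≤-refl
... | no _    | no _     | yes _    = ≤-refl
... | yes a≡b | yes πa≡b | _        =
  contradiction (trans πa≡b (sym a≡b)) (proj₁ (noShort a))
... | yes a≡b | _        | yes πb≡a =
  contradiction (subst (λ x → π ⟨$⟩ʳ x ≡ a) (sym a≡b) πb≡a) (proj₁ (noShort a))
... | _       | yes πa≡b | yes πb≡a =
  contradiction (trans (cong (π ⟨$⟩ʳ_) πa≡b) πb≡a) (proj₂ (noShort a))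

∑-cycleNbhd : (π : Permutation m m) → ∀ a → ∑[ b < m ] cycleNbhd π a b ≡ 3
∑-cycleNbhd {m} π a = begin
  ∑[ b < m ] (δ a b + (δ (π ⟨$⟩ʳ a) b + δ (π ⟨$⟩ʳ b) a))
    ≡⟨ ∑-distrib-+ (δ a) _ ⟩
  ∑[ b < m ] δ a b + ∑[ b < m ] (δ (π ⟨$⟩ʳ a) b + δ (π ⟨$⟩ʳ b) a)
    ≡⟨ cong (∑[ b < m ] δ a b +_) (∑-distrib-+ (δ (π ⟨$⟩ʳ a)) (λ b → δ (π ⟨$⟩ʳ b) a)) ⟩
  ∑[ b < m ] δ a b + (∑[ b < m ] δ (π ⟨$⟩ʳ a) b + ∑[ b < m ] δ (π ⟨$⟩ʳ b) a)
    ≡⟨ cong (λ s → ∑[ b < m ] δ a b + (∑[ b < m ] δ (π ⟨$⟩ʳ a) b + s)) (sum-cong-≗ preimage) ⟩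
  ∑[ b < m ] δ a b + (∑[ b < m ] δ (π ⟨$⟩ʳ a) b + ∑[ b < m ] δ (π ⟨$⟩ˡ a) b)
    ≡⟨ cong₂ _+_ (∑-δ a) (cong₂ _+_ (∑-δ (π ⟨$⟩ʳ a)) (∑-δ (π ⟨$⟩ˡ a))) ⟩
  3 ∎
  where
  open ≡-Reasoning
  preimage : ∀ b → δ (π ⟨$⟩ʳ b) a ≡ δ (π ⟨$⟩ˡ a) b
  preimage b = δ-⇔ (λ πb≡a → trans (sym (cong (π ⟨$⟩ˡ_) πb≡a)) (inverseˡ π))
                   (λ π⁻¹a≡b → trans (sym (cong (π ⟨$⟩ʳ_) π⁻¹a≡b)) (inverseʳ π))

cycleComplement : Permutation m m → Multigraph m
cycleComplement π = record
  { mult      = λ a b → 1 ∸ cycleNbhd π a b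
  ; symmetric = λ a b → cong (1 ∸_) (cycleNbhd-sym π a b)
  ; loopless  = loopless′
  }
  where
  loopless′ : ∀ a → 1 ∸ cycleNbhd π a a ≡ 0
  loopless′ a = trans (cong (λ x → 1 ∸ (x + cycle)) (δ-refl a)) (0∸n≡0 cycle)
    where
    cycle : ℕ
    cycle = δ (π ⟨$⟩ʳ a) a + δ (π ⟨$⟩ʳ a) a

cycleComplement-mult≤1 : (π : Permutation m m) → ∀ a b → mult (cycleComplement π) a b ≤ 1
cycleComplement-mult≤1 π a b = m∸n≤m 1 (cycleNbhd π a b)

deg-cycleComplement : (π : Permutation m m) → NoShortCycles π →
                      ∀ a → deg (cycleComplement π) a ≡ m ∸ 3
deg-cycleComplement {m} π noShort a = begin
  deg (cycleComplement π) a                ≡⟨ deg≡∑ (cycleComplement π) a ⟩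
  ∑[ b < m ] (1 ∸ cycleNbhd π a b)         ≡⟨ sym (m+n∸n≡m _ 3) ⟩
  ∑[ b < m ] (1 ∸ cycleNbhd π a b) + 3 ∸ 3 ≡⟨ cong (_∸ 3) complement+nbhd ⟩
  m ∸ 3                                    ∎
  where
  open ≡-Reasoning
  complement+nbhd : ∑[ b < m ] (1 ∸ cycleNbhd π a b) + 3 ≡ m
  complement+nbhd = begin
    ∑[ b < m ] (1 ∸ cycleNbhd π a b) + 3
      ≡⟨ cong (∑[ b < m ] (1 ∸ cycleNbhd π a b) +_) (sym (∑-cycleNbhd π a)) ⟩
    ∑[ b < m ] (1 ∸ cycleNbhd π a b) + ∑[ b < m ] cycleNbhd π a b
      ≡⟨ sym (∑-distrib-+ (λ b → 1 ∸ cycleNbhd π a b) (cycleNbhd π a)) ⟩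
    ∑[ b < m ] (1 ∸ cycleNbhd π a b + cycleNbhd π a b)
      ≡⟨ sum-cong-≗ (λ b → m∸n+n≡m (cycleNbhd≤1 π noShort a b)) ⟩
    ∑[ b < m ] 1
      ≡⟨ trans (∑-const m 1) (*-identityʳ m) ⟩
    m ∎

prev : Fin (suc n) → Fin (suc n)
prev zero    = fromℕ _
prev (suc i) = inject₁ i

next : Fin (suc n) → Fin (suc n)
next i with view i
... | ‵fromℕ     = zero
... | ‵inject₁ j = suc j

prev-next : (i : Fin (suc n)) → prev (next i) ≡ i
prev-next i with view i
... | ‵fromℕ     = refl
... | ‵inject₁ j = refl

next-prev : (i : Fin (suc n)) → next (prev i) ≡ i
next-prev {n} zero    rewrite view-fromℕ n   = refl
next-prev     (suc i) rewrite view-inject₁ i = refl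

rotation : Permutation (suc n) (suc n)
rotation = permutation prev next prev-next next-prev

rotation-noShortCycles : NoShortCycles (rotation {2 + n})
rotation-noShortCycles a = prev-≢ a , prev²-≢ a
  where
  prev-≢ : (a : Fin (3 + n)) → prev a ≢ a
  prev-≢ zero    ()
  prev-≢ (suc i) e = m≢1+n+m (toℕ i) {0} (trans (sym (toℕ-inject₁ i)) (cong toℕ e))
  prev²-≢ : (a : Fin (3 + n)) → prev (prev a) ≢ a
  prev²-≢ zero          ()
  prev²-≢ (suc zero)    ()
  prev²-≢ (suc (suc i)) e = m≢1+n+m (toℕ i) {1}
    (trans (sym (trans (toℕ-inject₁ (inject₁ i)) (toℕ-inject₁ i))) (cong toℕ e))

dhat-apex : ∀ m → dhat (2 + m) zero ≡ suc m * 2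
dhat-apex m = trans (cong (_∸ 2) (double-suc (suc m))) (m+n∸m≡n 2 (suc m * 2))
  where
  double-suc : ∀ m → 2 * suc m ≡ 2 + m * 2
  double-suc = solve-∀

cone²-realizes-dhat : (M : Multigraph m) → (∀ v → 4 + deg M v ≡ suc m) →
                      Realizes (cone 2 (cone 2 M)) (dhat (2 + m))
cone²-realizes-dhat {m} M deg≡ zero          = trans (deg-cone-apex 2 (cone 2 M)) (sym (dhat-apex m))
cone²-realizes-dhat {m} M deg≡ (suc zero)    = begin
  deg (cone 2 (cone 2 M)) (suc zero) ≡⟨ deg-cone-suc 2 (cone 2 M) zero ⟩
  2 + deg (cone 2 M) zero            ≡⟨ cong (2 +_) (deg-cone-apex 2 M) ⟩
  suc m * 2                          ≡⟨ sym (dhat-apex m) ⟩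
  dhat (2 + m) (suc zero)            ∎
  where open ≡-Reasoning
cone²-realizes-dhat {m} M deg≡ (suc (suc v)) = begin
  deg (cone 2 (cone 2 M)) (suc (suc v)) ≡⟨ deg-cone-suc 2 (cone 2 M) (suc v) ⟩
  2 + deg (cone 2 M) (suc v)            ≡⟨ cong (2 +_) (deg-cone-suc 2 M v) ⟩
  4 + deg M v                           ≡⟨ deg≡ v ⟩
  dhat (2 + m) (suc (suc v))            ∎
  where open ≡-Reasoning

dhat-MaxMult≥2 : (H : Multigraph (2 + m)) → Realizes H (dhat (2 + m)) → 2 ≤ MaxMult H
dhat-MaxMult≥2 {m} H realizes = *-cancelˡ-≤ (suc m) (begin
  suc m * 2          ≡⟨ sym (trans (realizes zero) (dhat-apex m)) ⟩
  deg H zero         ≤⟨ deg≤*MaxMult H zero ⟩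
  suc m * MaxMult H  ∎)
  where open ≤-Reasoning

dhat-TotMult : (H : Multigraph (2 + m)) → Realizes H (dhat (2 + m)) → MaxMult H ≡ 2 →
               2 * (2 + m) ∸ 3 ≤ TotMult H
dhat-TotMult {m} H realizes MaxMult≡2 = subst (_≤ TotMult H) (sym twice-minus-three)
  (TotMult-two-apexes H (doubled zero (dhat-apex m)) (doubled (suc zero) (dhat-apex m) ∘ suc))
  where
  doubled : ∀ v → dhat (2 + m) v ≡ suc m * 2 → ∀ u → 2 ≤ mult H v (punchIn v u)
  doubled v dhat≡ u = ≤-reflexive (sym (saturated H v (≤-reflexive MaxMult≡2)
                        (≤-reflexive (sym (trans (realizes v) dhat≡))) u))
  twice-minus-three : 2 * (2 + m) ∸ 3 ≡ suc m + m
  twice-minus-three = trans (cong (_∸ 3) (double m)) (m+n∸m≡n 3 (suc m + m))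
    where
    double : ∀ m → 2 * (2 + m) ≡ 3 + (suc m + m)
    double = solve-∀

lemma14 : (n : ℕ) → 5 ≤ n →
    MaxMultSeqIs (dhat n) 2 ×
    (∀ (H : Multigraph n) → Realizes H (dhat n) → MaxMult H ≡ 2 →
      2 * n ∸ 3 ≤ TotMult H)
lemma14 n 5≤n with m≤n⇒∃[o]m+o≡n 5≤n
... | k , refl = ((H , H-realizes , H-MaxMult≡2) , dhat-MaxMult≥2) , dhat-TotMult
  where
  C : Multigraph (3 + k)
  C = cycleComplement rotation
  H : Multigraph (5 + k)
  H = cone 2 (cone 2 C)
  H-realizes : Realizes H (dhat (5 + k))
  H-realizes = cone²-realizes-dhat C (cong (4 +_) ∘ deg-cycleComplement rotation rotation-noShortCycles)
  H-MaxMult≡2 : MaxMult H ≡ 2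
  H-MaxMult≡2 = ≤-antisym (MaxMult-least H (cone-mult≤ (cone 2 C) (cone-mult≤ C C-mult≤2)))
                          (dhat-MaxMult≥2 H H-realizes)
    where
    C-mult≤2 : ∀ a b → mult C a b ≤ 2
    C-mult≤2 a b = ≤-trans (cycleComplement-mult≤1 rotation a b) (n≤1+n 1)
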